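{- Let $n$ be a positive integer and let $n+1 = p_1^{x_1}\cdots p_\ell^{x_\ell}$ be the prime factorization of $n+1$ with primes $p_1<\dots<p_\ell$ and exponents $x_i \ge 1$. Let $r$ be an integer with $1 \le r < (n-2)/3$. Then $r \in T(n,n+1)$ if and only if all of the following hold: (i) $r+1 = p_I^{x_I}\cdots p_\ell^{x_\ell}$ for some index $2 \le I \le \ell$; (ii) $(n+1)/(r+1) - 1 = p_1^{x_1}\cdots p_{I-1}^{x_{I-1}} - 1 = p$ for some prime $p$; (iii) $p \le p_I$. Moreover, $0 \in T(n,n+1)$ if and only if $n = p_1^{x_1}\cdots p_\ell^{x_\ell} - 1$ is prime. Finally, if $n \equiv 2 \pmod 3$, then $(n-2)/3 \in T(n,n+1)$.
   Context: $n \bmod k$ denotes the least nonnegative remainder of $n$ upon division by $k$. $S(n) := \{ n \bmod k : k \in \{1,2,\ldots,\lfloor n/2\rfloor\}\}$ and $T(n,n+1) := \{ r : r \in S(n) \text{ and } r+1 \notin S(n+1)\}$. -}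

module Defs where

open import Data.Nat using (ℕ; zero; suc; _+_; _*_; _∸_; _^_; _≤_; _<_)
open import Data.Nat.DivMod using (_/_; _%_)
open import Data.Nat.Primality using (Prime)
open import Data.Product using (_×_; _,_; proj₁; proj₂; ∃-syntax)
open import Data.List using (List; []; _∷_; foldr)
open import Data.List.Relation.Unary.All using (All)
open import Data.List.Relation.Unary.Linked using (Linked)
open import Relation.Binary.PropositionalEquality using (_≡_)
open import Relation.Nullary using (¬_)

-- r ∈ S(n) : r = n mod k for some k ∈ {1, …, ⌊n/2⌋}.
-- k is written as suc k' (k' ≥ 0) so that the divisor is syntactically nonzero.
InS : ℕ → ℕ → Set
InS n r = ∃[ k' ] (suc k' ≤ n / 2 × n % suc k' ≡ r)

InT : ℕ → ℕ → Set
InT n r = InS n r × ¬ InS (suc n) (suc r)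

prodPP : List (ℕ × ℕ) → ℕ
prodPP = foldr (λ px acc → proj₁ px ^ proj₂ px * acc) 1

IsPrimeFactorization : ℕ → List (ℕ × ℕ) → Set
IsPrimeFactorization m fac =
  All (λ px → Prime (proj₁ px)) fac ×
  All (λ px → 1 ≤ proj₂ px) fac ×
  Linked (λ a b → proj₁ a < proj₁ b) fac ×
  prodPP fac ≡ m

{-# OPTIONS --safe #-}
module Submission where

-- If r = n mod k and k ≠ r+1, then k > r+1 and n+1 leaves remainder r+1 modulo the same k;
-- so r ∈ T(n,n+1) forces k = r+1 and n = r + p(r+1) with p ≥ 2. Then r+1 ∈ S(n+1) means
-- p(r+1) = c·K with 2 ≤ c and K > r+1, i.e. p(r+1) has a nontrivial divisor c < p. Hence
-- r ∈ T(n,n+1) iff p is prime and r+1 is p-rough. When 3r+2 < n the prime p is odd, so every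
-- prime factor of p+1 lies below p while every prime factor of r+1 is at least p, and
-- n+1 = (p+1)(r+1) cuts the sorted factorisation of n+1 at p.

open import Defs
open import Data.Nat.Base
  using (ℕ; zero; suc; _+_; _*_; _∸_; _^_; _≤_; _<_; z≤n; s≤s; s≤s⁻¹;
         NonZero; NonTrivial; nonTrivial⇒n>1; n>1⇒nonTrivial; nonTrivial⇒nonZero; nonTrivial⇒≢1)
open import Data.Nat.Properties
open import Data.Nat.DivMod
  using (_/_; _%_; m≡m%n+[m/n]*n; [m+kn]%n≡m%n; m<n⇒m%n≡m; m%n<n; m*n/n≡m; m/n*n≤m; /-monoˡ-≤)
open import Data.Nat.Divisibility
open import Data.Nat.Coprimality using (Coprime; coprime-divisor; prime⇒coprime)
import Data.Nat.Coprimality as Coprimality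
open import Data.Nat.Primality
open import Data.Nat.Primality.Factorisation using (factorise)
open import Data.Nat.ListAction using (product)
open import Data.Nat.Tactic.RingSolver using (solve-∀)
open import Data.Product using (_×_; _,_; proj₁; ∃-syntax)
open import Data.Sum using (_⊎_; inj₁; inj₂)
open import Data.List using (List; []; _∷_; length; take; drop)
open import Data.List.Relation.Unary.All as All using (All; []; _∷_)
open import Data.List.Relation.Unary.All.Properties using (take⁺; drop⁺)
open import Data.List.Relation.Unary.AllPairs using (AllPairs; []; _∷_)
import Data.List.Relation.Unary.AllPairs.Properties as AllPairs
open import Data.List.Relation.Unary.Linked.Properties using (Linked⇒AllPairs)
open import Function.Base using (_∘_; _on_)
open import Function.Bundles using (_⇔_; mk⇔; Equivalence)
open import Relation.Binary.PropositionalEquality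
  using (_≡_; _≢_; refl; sym; trans; cong; cong₂; subst; module ≡-Reasoning)
open import Relation.Nullary using (¬_; yes; no; contradiction)

open Equivalence using (to; from)

*≤⇒≤/ : ∀ {k m} n .{{_ : NonZero n}} → k * n ≤ m → k ≤ m / n
*≤⇒≤/ {k} n k*n≤m = subst (_≤ _) (m*n/n≡m k n) (/-monoˡ-≤ n k*n≤m)

≤/⇒*≤ : ∀ {k m} n .{{_ : NonZero n}} → k ≤ m / n → k * n ≤ m
≤/⇒*≤ {m = m} n k≤m/n = ≤-trans (*-monoˡ-≤ n k≤m/n) (m/n*n≤m m n)

quotient≥2 : ∀ {s c K} → s < K → K * 2 ≤ s + c * K → 2 ≤ c
quotient≥2 {s} {c} {K} s<K K*2≤m = s≤s⁻¹ (*-cancelˡ-< K 2 (suc c) (begin-strict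
  K * 2      ≤⟨ K*2≤m ⟩
  s + c * K  <⟨ +-monoˡ-< (c * K) s<K ⟩
  K + c * K  ≡⟨ *-comm (suc c) K ⟩
  K * suc c  ∎))
  where open ≤-Reasoning

InS⇔ : ∀ {m s} → InS m s ⇔ (∃[ c ] ∃[ K ] (2 ≤ c × s < K × m ≡ s + c * K))
InS⇔ {m} {s} = mk⇔ toDivision fromDivision
  where
  toDivision : InS m s → ∃[ c ] ∃[ K ] (2 ≤ c × s < K × m ≡ s + c * K)
  toDivision (k , K≤m/2 , m%K≡s) = m / suc k , suc k , 2≤c , s<K , m≡
    where
    s<K : s < suc k
    s<K = subst (_< suc k) m%K≡s (m%n<n m (suc k))
    m≡ : m ≡ s + m / suc k * suc k
    m≡ = trans (m≡m%n+[m/n]*n m (suc k)) (cong (_+ m / suc k * suc k) m%K≡s)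
    2≤c : 2 ≤ m / suc k
    2≤c = quotient≥2 s<K (subst (suc k * 2 ≤_) m≡ (≤/⇒*≤ 2 K≤m/2))
  fromDivision : ∃[ c ] ∃[ K ] (2 ≤ c × s < K × m ≡ s + c * K) → InS m s
  fromDivision (c , suc k , 2≤c , s<K , m≡) = k , *≤⇒≤/ 2 K*2≤m , m%K≡s
    where
    K*2≤m : suc k * 2 ≤ m
    K*2≤m = begin
      suc k * 2      ≡⟨ *-comm (suc k) 2 ⟩
      2 * suc k      ≤⟨ *-monoˡ-≤ (suc k) 2≤c ⟩
      c * suc k      ≤⟨ m≤n+m _ s ⟩
      s + c * suc k  ≡⟨ m≡ ⟨
      m              ∎
      where open ≤-Reasoning
    m%K≡s : m % suc k ≡ s
    m%K≡s = trans (cong (_% suc k) m≡) (trans ([m+kn]%n≡m%n s c (suc k)) (m<n⇒m%n≡m s<K))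

InS[1+n,1+r]⇔divisor<p : ∀ {n r p} .{{_ : NonZero p}} → n ≡ r + p * suc r →
                         InS (suc n) (suc r) ⇔ (p * suc r) HasNonTrivialDivisorLessThan p
InS[1+n,1+r]⇔divisor<p {n} {r} {p} n≡ = mk⇔ toDivisor fromDivisor
  where
  open ≤-Reasoning
  toDivisor : InS (suc n) (suc r) → (p * suc r) HasNonTrivialDivisorLessThan p
  toDivisor inS with c , K , 2≤c , 1+r<K , 1+n≡ ← to InS⇔ inS =
    hasNonTrivialDivisor {{n>1⇒nonTrivial 2≤c}} c<p (divides K (trans p[1+r]≡cK (*-comm c K)))
    where
    p[1+r]≡cK : p * suc r ≡ c * K
    p[1+r]≡cK = +-cancelˡ-≡ (suc r) _ _ (trans (sym (cong suc n≡)) 1+n≡)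
    c<p : c < p
    c<p = *-cancelʳ-< K c p (begin-strict
      c * K      ≡⟨ p[1+r]≡cK ⟨
      p * suc r  <⟨ *-monoʳ-< p 1+r<K ⟩
      p * K      ∎)
  fromDivisor : (p * suc r) HasNonTrivialDivisorLessThan p → InS (suc n) (suc r)
  fromDivisor (hasNonTrivialDivisor {d} d<p (divides e p[1+r]≡ed)) =
    from InS⇔ (d , e , nonTrivial⇒n>1 d , 1+r<e , cong suc (trans n≡ (cong (r +_) p[1+r]≡de)))
    where
    p[1+r]≡de : p * suc r ≡ d * e
    p[1+r]≡de = trans p[1+r]≡ed (*-comm e d)
    1+r<e : suc r < e
    1+r<e = *-cancelˡ-< d (suc r) e (begin-strict
      d * suc r  <⟨ *-monoˡ-< (suc r) d<p ⟩
      p * suc r  ≡⟨ p[1+r]≡de ⟩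
      d * e      ∎)

rough[p*m]⇔prime×rough[m] : ∀ {p m} .{{_ : NonTrivial p}} → p Rough (p * m) ⇔ (Prime p × p Rough m)
rough[p*m]⇔prime×rough[m] {p} {m} = mk⇔
  (λ ρ → prime (rough∧∣⇒rough ρ (m∣m*n m)) , rough∧∣⇒rough ρ (n∣m*n p))
  (λ (pp , ρ) (hasNonTrivialDivisor {d} d<p d∣pm) →
    ρ (hasNonTrivialDivisor d<p
      (coprime-divisor (Coprimality.sym (prime⇒coprime pp {{nonTrivial⇒nonZero d}} d<p)) d∣pm)))

∉S[1+n,1+r]⇔prime×rough : ∀ {n r p} .{{_ : NonTrivial p}} → n ≡ r + p * suc r →
                          (¬ InS (suc n) (suc r)) ⇔ (Prime p × p Rough suc r)
∉S[1+n,1+r]⇔prime×rough {p = p} n≡ = mk⇔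
  (λ ∉S → to rough[p*m]⇔prime×rough[m] (∉S ∘ from (InS[1+n,1+r]⇔divisor<p n≡)))
  (λ prime×rough → from rough[p*m]⇔prime×rough[m] prime×rough ∘ to (InS[1+n,1+r]⇔divisor<p n≡))
  where instance p≢0 : NonZero p
                 p≢0 = nonTrivial⇒nonZero p

InT⇒n≡r+c*[1+r] : ∀ {n r} → InT n r → ∃[ c ] (2 ≤ c × n ≡ r + c * suc r)
InT⇒n≡r+c*[1+r] {n} {r} (inS , ∉S) with c , K , 2≤c , r<K , n≡ ← to InS⇔ inS with K ≟ suc r
... | yes refl = c , 2≤c , n≡
... | no K≢1+r =
  contradiction (from InS⇔ (c , K , 2≤c , ≤∧≢⇒< r<K (K≢1+r ∘ sym) , cong suc n≡)) ∉S

InT⇔ : ∀ {n r} → InT n r ⇔ (∃[ p ] (n ≡ r + p * suc r × Prime p × p Rough suc r))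
InT⇔ {n} {r} = mk⇔ toPrime fromPrime
  where
  toPrime : InT n r → ∃[ p ] (n ≡ r + p * suc r × Prime p × p Rough suc r)
  toPrime t@(_ , ∉S) with c , 2≤c , n≡ ← InT⇒n≡r+c*[1+r] t =
    c , n≡ , to (∉S[1+n,1+r]⇔prime×rough {{n>1⇒nonTrivial 2≤c}} n≡) ∉S
  fromPrime : ∃[ p ] (n ≡ r + p * suc r × Prime p × p Rough suc r) → InT n r
  fromPrime (p , n≡ , pp , ρ) =
    from InS⇔ (p , suc r , nonTrivial⇒n>1 p {{prime⇒nonTrivial pp}} , ≤-refl , n≡) ,
    from (∉S[1+n,1+r]⇔prime×rough {{prime⇒nonTrivial pp}} n≡) (pp , ρ)

prime⇒∤1 : ∀ {q} → Prime q → ¬ q ∣ 1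
prime⇒∤1 pq q∣1 = ¬prime[1] (subst Prime (∣1⇒≡1 q∣1) pq)

primeFactor : ∀ {m} → m ≢ 1 → ∃[ q ] (Prime q × q ∣ m)
primeFactor {zero} _ = 2 , prime[2] , (2 ∣0)
primeFactor {suc zero} m≢1 = contradiction refl m≢1
primeFactor {m@(suc (suc _))} _ with factorise m
... | record { factors = [] ; isFactorisation = m≡1 } = contradiction m≡1 λ ()
... | record { factors = q ∷ qs ; isFactorisation = m≡ ; factorsPrime = pq ∷ _ } =
  q , pq , divides (product qs) (trans m≡ (*-comm q (product qs)))

PrimeFactorsBelow : ℕ → ℕ → Set
PrimeFactorsBelow p a = ∀ {q} → Prime q → q ∣ a → q < p

rough⇒primeFactors≥ : ∀ {p m q} → p Rough m → Prime q → q ∣ m → p ≤ q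
rough⇒primeFactors≥ ρ pq q∣m =
  ≮⇒≥ λ q<p → ρ (hasNonTrivialDivisor {{prime⇒nonTrivial pq}} q<p q∣m)

primeFactors≥⇒rough : ∀ {p m} → (∀ {q} → Prime q → q ∣ m → p ≤ q) → p Rough m
primeFactors≥⇒rough bound (hasNonTrivialDivisor {d} d<p d∣m)
  with q , pq , q∣d ← primeFactor (nonTrivial⇒≢1 {d}) =
  <⇒≱ (≤-<-trans (∣⇒≤ {{nonTrivial⇒nonZero d}} q∣d) d<p) (bound pq (∣-trans q∣d d∣m))

below∧rough⇒coprime : ∀ {p a b} → PrimeFactorsBelow p a → p Rough b → Coprime a b
below∧rough⇒coprime below ρ {d} (d∣a , d∣b) with d ≟ 1
... | yes d≡1 = d≡1
... | no d≢1 with q , pq , q∣d ← primeFactor d≢1 =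
  contradiction (below pq (∣-trans q∣d d∣a)) (≤⇒≯ (rough⇒primeFactors≥ ρ pq (∣-trans q∣d d∣b)))

below*rough-unique : ∀ {p a b a′ b′} .{{_ : NonZero a′}} → a * b ≡ a′ * b′ →
                     PrimeFactorsBelow p a → p Rough b → PrimeFactorsBelow p a′ → p Rough b′ →
                     a ≡ a′ × b ≡ b′
below*rough-unique {a = a} {b} {a′} {b′} ab≡a′b′ below ρ below′ ρ′ =
  a≡a′ , *-cancelˡ-≡ b b′ a′ (subst (λ x → x * b ≡ a′ * b′) a≡a′ ab≡a′b′)
  where
  a∣a′ : a ∣ a′
  a∣a′ = coprime-divisor (below∧rough⇒coprime below ρ′)
           (subst (a ∣_) (trans ab≡a′b′ (*-comm a′ b′)) (m∣m*n b))
  a′∣a : a′ ∣ a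
  a′∣a = coprime-divisor (below∧rough⇒coprime below′ ρ)
           (subst (a′ ∣_) (trans (sym ab≡a′b′) (*-comm a b)) (m∣m*n b′))
  a≡a′ : a ≡ a′
  a≡a′ = ∣-antisym a∣a′ a′∣a

2∣n⊎2∣1+n : ∀ n → 2 ∣ n ⊎ 2 ∣ suc n
2∣n⊎2∣1+n zero = inj₁ (2 ∣0)
2∣n⊎2∣1+n (suc n) with 2∣n⊎2∣1+n n
... | inj₁ (divides k n≡k*2) = inj₂ (divides (suc k) (cong (2 +_) n≡k*2))
... | inj₂ 2∣1+n = inj₁ 2∣1+n

primeFactorsBelow[1+p] : ∀ {p} → Prime p → 2 < p → PrimeFactorsBelow p (suc p)
primeFactorsBelow[1+p] {p} pp 2<p {q} pq q∣1+p with m≤n⇒m<n∨m≡n (∣⇒≤ q∣1+p)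
... | inj₁ q<1+p with m≤n⇒m<n∨m≡n (s≤s⁻¹ q<1+p)
...   | inj₁ q<p = q<p
...   | inj₂ refl = contradiction (∣m+n∣m⇒∣n (subst (p ∣_) (+-comm 1 p) q∣1+p) ∣-refl) (prime⇒∤1 pp)
primeFactorsBelow[1+p] {p} pp 2<p pq q∣1+p | inj₂ refl with 2∣n⊎2∣1+n p
... | inj₁ 2∣p = contradiction (hasNonTrivialDivisor 2<p 2∣p) (prime⇒rough pp)
... | inj₂ 2∣1+p = contradiction (hasNonTrivialDivisor (m<n⇒m<1+n 2<p) 2∣1+p) (prime⇒rough pq)

prime∣^⇒∣ : ∀ {q} a k → Prime q → q ∣ a ^ k → q ∣ a
prime∣^⇒∣ a zero pq q∣1 = contradiction q∣1 (prime⇒∤1 pq)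
prime∣^⇒∣ a (suc k) pq q∣a^[1+k] with euclidsLemma a (a ^ k) pq q∣a^[1+k]
... | inj₁ q∣a = q∣a
... | inj₂ q∣a^k = prime∣^⇒∣ a k pq q∣a^k

prime∣prodPP⇒ : ∀ {P : ℕ → Set} {q} L → All (Prime ∘ proj₁) L → All (P ∘ proj₁) L →
                Prime q → q ∣ prodPP L → P q
prime∣prodPP⇒ [] _ _ pq q∣1 = contradiction q∣1 (prime⇒∤1 pq)
prime∣prodPP⇒ ((a , k) ∷ L) (pa ∷ ps) (Pa ∷ Ps) pq q∣prod
  with euclidsLemma (a ^ k) (prodPP L) pq q∣prod
... | inj₂ q∣L = prime∣prodPP⇒ L ps Ps pq q∣L
... | inj₁ q∣a^k with prime⇒irreducible pa (prime∣^⇒∣ a k pq q∣a^k)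
...   | inj₁ q≡1 = contradiction (subst Prime q≡1 pq) ¬prime[1]
...   | inj₂ refl = Pa

prodPP-rough : ∀ {p} L → All (Prime ∘ proj₁) L → All ((p ≤_) ∘ proj₁) L → p Rough prodPP L
prodPP-rough L ps p≤L = primeFactors≥⇒rough (prime∣prodPP⇒ L ps p≤L)

prodPP-take*drop : ∀ j L → prodPP (take j L) * prodPP (drop j L) ≡ prodPP L
prodPP-take*drop zero L = +-identityʳ (prodPP L)
prodPP-take*drop (suc j) [] = refl
prodPP-take*drop (suc j) ((a , k) ∷ L) =
  trans (*-assoc (a ^ k) _ _) (cong (a ^ k *_) (prodPP-take*drop j L))

prodPP[take]≢1⇒1≤ : ∀ j L → prodPP (take j L) ≢ 1 → 1 ≤ j
prodPP[take]≢1⇒1≤ zero L ≢1 = contradiction refl ≢1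
prodPP[take]≢1⇒1≤ (suc j) L _ = s≤s z≤n

prodPP[drop]≢1⇒∷ : ∀ j L → prodPP (drop j L) ≢ 1 →
                   j < length L × ∃[ a ] ∃[ rest ] (drop j L ≡ a ∷ rest)
prodPP[drop]≢1⇒∷ zero [] ≢1 = contradiction refl ≢1
prodPP[drop]≢1⇒∷ (suc j) [] ≢1 = contradiction refl ≢1
prodPP[drop]≢1⇒∷ zero (a ∷ L) _ = s≤s z≤n , a , L , refl
prodPP[drop]≢1⇒∷ (suc j) (a ∷ L) ≢1 with j<len , rest ← prodPP[drop]≢1⇒∷ j L ≢1 =
  s≤s j<len , rest

≤head⇒≤all : ∀ {p} {a : ℕ × ℕ} {L} → p ≤ proj₁ a → AllPairs (_<_ on proj₁) (a ∷ L) →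
             All ((p ≤_) ∘ proj₁) (a ∷ L)
≤head⇒≤all p≤a (a<L ∷ _) = p≤a ∷ All.map (λ a<b → ≤-trans p≤a (<⇒≤ a<b)) a<L

cut : ∀ p {L : List (ℕ × ℕ)} → AllPairs (_<_ on proj₁) L →
      ∃[ j ] (All ((_< p) ∘ proj₁) (take j L) × All ((p ≤_) ∘ proj₁) (drop j L))
cut p [] = 0 , [] , []
cut p {a ∷ L} sorted@(_ ∷ sortedL) with proj₁ a <? p
... | no a≮p = 0 , [] , ≤head⇒≤all (≮⇒≥ a≮p) sorted
... | yes a<p with j , below , above ← cut p sortedL = suc j , a<p ∷ below , above

∸1≡⇒≡suc : ∀ {m p} .{{_ : NonZero p}} → m ∸ 1 ≡ p → m ≡ suc p
∸1≡⇒≡suc {suc m} refl = refl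

factorisation-sorted : ∀ {m fac} → IsPrimeFactorization m fac → AllPairs (_<_ on proj₁) fac
factorisation-sorted (_ , _ , linked , _) = Linked⇒AllPairs <-trans linked

FactorisationCut : ℕ → ℕ → List (ℕ × ℕ) → Set
FactorisationCut n r fac =
  ∃[ j ] (1 ≤ j × j < length fac ×
    suc r ≡ prodPP (drop j fac) ×
    (∃[ p ] (Prime p ×
      (suc n / suc r) ∸ 1 ≡ p ×
      prodPP (take j fac) ∸ 1 ≡ p ×
      (∃[ q ] ∃[ x ] ∃[ rest ] (drop j fac ≡ (q , x) ∷ rest × p ≤ q)))))

rough⇒FactorisationCut : ∀ {n r p fac} → IsPrimeFactorization (suc n) fac → 1 ≤ r →
                         n ≡ r + p * suc r → Prime p → 2 < p → p Rough suc r →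
                         FactorisationCut n r fac
rough⇒FactorisationCut {n} {r} {p} {fac} isFac@(ps , _ , _ , fac≡) 1≤r n≡ pp 2<p ρ
  with j , below , above ← cut p (factorisation-sorted isFac)
  with take≡ , drop≡ ← below*rough-unique
         (trans (prodPP-take*drop j fac) (trans fac≡ (cong suc n≡)))
         (prime∣prodPP⇒ (take j fac) (take⁺ j ps) below)
         (prodPP-rough (drop j fac) (drop⁺ j ps) above)
         (primeFactorsBelow[1+p] pp 2<p) ρ
  with j<len , (q , x) , rest , drop≡∷ ←
         prodPP[drop]≢1⇒∷ j fac (m<n⇒n≢0 1≤r ∘ suc-injective ∘ trans (sym drop≡))
  = j , prodPP[take]≢1⇒1≤ j fac (m<n⇒n≢0 2<p ∘ suc-injective ∘ trans (sym take≡)) ,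
    j<len , sym drop≡ ,
    p , pp , trans (cong (λ m → m / suc r ∸ 1) (cong suc n≡)) (cong (_∸ 1) (m*n/n≡m (suc p) (suc r))) ,
    cong (_∸ 1) take≡ ,
    q , x , rest , drop≡∷ , All.head (subst (All ((p ≤_) ∘ proj₁)) drop≡∷ above)

FactorisationCut⇒rough : ∀ {n r fac} → IsPrimeFactorization (suc n) fac → FactorisationCut n r fac →
                         ∃[ p ] (n ≡ r + p * suc r × Prime p × p Rough suc r)
FactorisationCut⇒rough {n} {r} {fac} isFac@(ps , _ , _ , fac≡)
  (j , _ , _ , 1+r≡ , p , pp , _ , take∸1≡p , q , x , rest , drop≡∷ , p≤q) = p , n≡ , pp , ρ
  where
  take≡ : prodPP (take j fac) ≡ suc p
  take≡ = ∸1≡⇒≡suc {{prime⇒nonZero pp}} take∸1≡p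
  n≡ : n ≡ r + p * suc r
  n≡ = suc-injective (begin
    suc n                                         ≡⟨ fac≡ ⟨
    prodPP fac                                    ≡⟨ prodPP-take*drop j fac ⟨
    prodPP (take j fac) * prodPP (drop j fac)     ≡⟨ cong₂ _*_ take≡ (sym 1+r≡) ⟩
    suc p * suc r                                 ∎)
    where open ≡-Reasoning
  p≤drop : All ((p ≤_) ∘ proj₁) (drop j fac)
  p≤drop = subst (All ((p ≤_) ∘ proj₁)) (sym drop≡∷)
             (≤head⇒≤all p≤q (subst (AllPairs _) drop≡∷ sorted-drop))
    where
    sorted-drop : AllPairs (_<_ on proj₁) (drop j fac)
    sorted-drop = AllPairs.drop⁺ j (factorisation-sorted isFac)
  ρ : p Rough suc r
  ρ = subst (p Rough_) (sym 1+r≡) (prodPP-rough (drop j fac) (drop⁺ j ps) p≤drop)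

3r+2<n⇒2<p : ∀ {n r p} → n ≡ r + p * suc r → 3 * r + 2 < n → 2 < p
3r+2<n⇒2<p {n} {r} {p} n≡ 3r+2<n = ≰⇒> λ p≤2 → <⇒≱ 3r+2<n (begin
  n              ≡⟨ n≡ ⟩
  r + p * suc r  ≤⟨ +-monoʳ-≤ r (*-monoˡ-≤ (suc r) p≤2) ⟩
  r + 2 * suc r  ≡⟨ r+2[1+r]≡3r+2 r ⟩
  3 * r + 2      ∎)
  where
  open ≤-Reasoning
  r+2[1+r]≡3r+2 : ∀ r → r + 2 * suc r ≡ 3 * r + 2
  r+2[1+r]≡3r+2 = solve-∀

InT⇔FactorisationCut : ∀ {n r fac} → IsPrimeFactorization (suc n) fac → 1 ≤ r → 3 * r + 2 < n →
                       InT n r ⇔ FactorisationCut n r fac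
InT⇔FactorisationCut isFac 1≤r 3r+2<n = mk⇔
  (λ t → let p , n≡ , pp , ρ = to InT⇔ t in
    rough⇒FactorisationCut isFac 1≤r n≡ pp (3r+2<n⇒2<p n≡ 3r+2<n) ρ)
  (from InT⇔ ∘ FactorisationCut⇒rough isFac)

InT[n,0]⇔prime : ∀ {n} → InT n 0 ⇔ Prime n
InT[n,0]⇔prime {n} = mk⇔
  (λ t → let p , n≡p*1 , pp , _ = to InT⇔ t in subst Prime (sym (trans n≡p*1 (*-identityʳ p))) pp)
  (λ pn → from InT⇔ (n , sym (*-identityʳ n) , pn , rough-1 n))

n%3≡2⇒InT[n,[n∸2]/3] : ∀ {n} → n % 3 ≡ 2 → InT n ((n ∸ 2) / 3)
n%3≡2⇒InT[n,[n∸2]/3] {n} n%3≡2 =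
  subst (InT n) (sym [n∸2]/3≡n/3)
    (from InT⇔ (2 , trans n≡ (2+3r≡r+2[1+r] (n / 3)) , prime[2] , 2-rough))
  where
  n≡ : n ≡ 2 + n / 3 * 3
  n≡ = trans (m≡m%n+[m/n]*n n 3) (cong (_+ n / 3 * 3) n%3≡2)
  [n∸2]/3≡n/3 : (n ∸ 2) / 3 ≡ n / 3
  [n∸2]/3≡n/3 = trans (cong (λ m → (m ∸ 2) / 3) n≡) (m*n/n≡m (n / 3) 3)
  2+3r≡r+2[1+r] : ∀ r → 2 + r * 3 ≡ r + 2 * suc r
  2+3r≡r+2[1+r] = solve-∀

lemma4p6 : (n : ℕ) → 1 ≤ n →
    ((fac : List (ℕ × ℕ)) → IsPrimeFactorization (suc n) fac →
      (r : ℕ) → 1 ≤ r → 3 * r + 2 < n →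
      (InT n r ⇔
        (∃[ j ] (1 ≤ j × j < length fac ×
          suc r ≡ prodPP (drop j fac) ×
          (∃[ p ] (Prime p ×
            (suc n / suc r) ∸ 1 ≡ p ×
            prodPP (take j fac) ∸ 1 ≡ p ×
            (∃[ q ] ∃[ x ] ∃[ rest ] (drop j fac ≡ (q , x) ∷ rest × p ≤ q))))))))
    × (InT n 0 ⇔ Prime n)
    × (n % 3 ≡ 2 → InT n ((n ∸ 2) / 3))
lemma4p6 n _ =
  (λ fac isFac r 1≤r 3r+2<n → InT⇔FactorisationCut isFac 1≤r 3r+2<n) ,
  InT[n,0]⇔prime ,
  n%3≡2⇒InT[n,[n∸2]/3]
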